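{- Let $E$ be a finite set. The U-matroid rank functions on $E$ are precisely the restrictions $\rho|_{\mathcal{D}}$ of matroid rank functions $\rho:2^E\to\mathbb{N}$ to accessible distributive sublattices $\mathcal{D}\subseteq2^E$.
   Context: An accessible distributive sublattice $\mathcal{D}\subseteq2^E$ contains $\emptyset,E$, is closed under union and intersection, and every nonempty $A\in\mathcal{D}$ contains some $x$ with $A\setminus\{x\}\in\mathcal{D}$. A U-matroid rank function on $E$ is a function $\rho:\mathcal{D}\to\mathbb{N}$ on such a lattice satisfying $\rho(\emptyset)=0$, monotonicity, submodularity ($\rho(A)+\rho(B)\ge\rho(A\cup B)+\rho(A\cap B)$), and unit increase ($\rho(A\cup\{e\})-\rho(A)\le1$ whenever $A,A\cup\{e\}\in\mathcal{D}$). A matroid rank function is such a function with $\mathcal{D}=2^E$. -}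

module Defs where

open import Data.Nat using (ℕ; _≤_; _+_)
open import Data.Bool using (Bool; true; T)
open import Data.Fin using (Fin)
open import Data.Fin.Subset using (Subset; ⊥; ⊤; ⁅_⁆; _∈_; _⊆_; _∩_; _∪_; _─_; Nonempty)
open import Data.Product using (Σ; ∃; _×_)
open import Relation.Binary.PropositionalEquality using (_≡_)

InFam : ∀ {n} → (Subset n → Bool) → Subset n → Set
InFam D A = T (D A)

record IsAccessibleDistributiveSublattice {n} (D : Subset n → Bool) : Set where
  field
    has-∅    : InFam D ⊥
    has-E    : InFam D ⊤
    ∪-closed : ∀ A B → InFam D A → InFam D B → InFam D (A ∪ B)
    ∩-closed : ∀ A B → InFam D A → InFam D B → InFam D (A ∩ B)
    accessible : ∀ A → InFam D A → Nonempty A →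
                 ∃ λ x → x ∈ A × InFam D (A ─ ⁅ x ⁆)

record IsURank {n} (D : Subset n → Bool) (ρ : (A : Subset n) → InFam D A → ℕ) : Set where
  field
    rank-∅   : (p : InFam D ⊥) → ρ ⊥ p ≡ 0
    monotone : ∀ A B (pA : InFam D A) (pB : InFam D B) → A ⊆ B → ρ A pA ≤ ρ B pB
    submodular : ∀ A B (pA : InFam D A) (pB : InFam D B)
                   (pU : InFam D (A ∪ B)) (pI : InFam D (A ∩ B)) →
                   ρ (A ∪ B) pU + ρ (A ∩ B) pI ≤ ρ A pA + ρ B pB
    unit-increase : ∀ A e (pA : InFam D A) (pAe : InFam D (A ∪ ⁅ e ⁆)) →
                    ρ (A ∪ ⁅ e ⁆) pAe ≤ ρ A pA + 1

Full : ∀ {n} → Subset n → Bool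
Full _ = true

IsMatroidRank : ∀ {n} → (Subset n → ℕ) → Set
IsMatroidRank {n} r = IsURank (Full {n}) (λ A _ → r A)

-- Restricting a matroid rank function to D preserves all four axioms. Conversely, a U-matroid
-- rank function ρ on D extends to
--   r X = min { ρ B + ∣ X ─ B ∣ : B ∈ D },
-- which is a matroid rank function because B ↦ ρ B and (X , B) ↦ ∣ X ─ B ∣ are jointly
-- submodular and D is a lattice. It agrees with ρ on D because ρ A ≤ ρ (A ∪ B) ≤ ρ B + ∣ A ─ B ∣
-- for A, B ∈ D: accessibility strips A one element at a time without leaving D, and putting an
-- element back into the union costs at most one by unit increase, and nothing if it lies in B.
module Submission where

open import Defs
open import Data.Nat using (ℕ; zero; suc; _≤_; _<_; _+_; _⊓_; z≤n; s≤s)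
open import Data.Nat.Properties
open import Data.Nat.Induction using (<-wellFounded)
open import Data.Bool using (Bool; true; false; T; _∨_)
open import Data.Bool.Properties using (T-irrelevant; ∨-identityʳ)
open import Data.Vec using ([]; _∷_; [_]; head; tail; here; there)
open import Data.Fin using (Fin)
open import Data.Unit using (tt)
open import Data.Fin.Subset
  using (Subset; inside; outside; ⊥; ⊤; ⁅_⁆; _∈_; _∉_; _⊆_; _∩_; _∪_; _─_; _-_; ∣_∣)
open import Data.Fin.Subset.Properties
  using ( drop-∷-⊆; _∈?_; nonempty?; Empty-unique; ∣⊥∣≡0; ∣⁅x⁆∣≡1; p⊆q⇒∣p∣≤∣q∣; ∣p∣≤∣x∷p∣
        ; ∪-assoc; ∪-comm; ∪-identityˡ; ∪-identityʳ; p⊆p∪q; p─⊥≡p; p─⊤≡⊥; p─q─r≡p─r─q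
        ; x∈p∧x∉q⇒x∈p─q; p─q⊆p; ∣p─q∣≤∣p∣; x∈p⇒∣p-x∣<∣p∣ )
open import Data.Product using (∃; ∃₂; _×_; _,_)
open import Data.Sum using (_⊎_; inj₁; inj₂)
open import Function.Bundles using (_⇔_; mk⇔)
open import Induction.WellFounded using (Acc; acc)
open import Relation.Nullary using (yes; no)
open import Relation.Binary.PropositionalEquality
  using (_≡_; refl; sym; trans; cong; cong₂; subst; subst₂; module ≡-Reasoning)
open import Algebra.Properties.CommutativeSemigroup +-commutativeSemigroup using (interchange)

private
  variable
    n : ℕ

p─p≡⊥ : (p : Subset n) → p ─ p ≡ ⊥
p─p≡⊥ []            = refl
p─p≡⊥ (inside  ∷ p) = cong (outside ∷_) (p─p≡⊥ p)
p─p≡⊥ (outside ∷ p) = cong (outside ∷_) (p─p≡⊥ p)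

∣p─p∣≡0 : (p : Subset n) → ∣ p ─ p ∣ ≡ 0
∣p─p∣≡0 {n} p = trans (cong ∣_∣ (p─p≡⊥ p)) (∣⊥∣≡0 n)

∣p─⊤∣≡0 : (p : Subset n) → ∣ p ─ ⊤ ∣ ≡ 0
∣p─⊤∣≡0 {n} p = trans (cong ∣_∣ (p─⊤≡⊥ p)) (∣⊥∣≡0 n)

─-distribʳ-∪ : (p q r : Subset n) → (p ∪ q) ─ r ≡ (p ─ r) ∪ (q ─ r)
─-distribʳ-∪ []      []      []            = refl
─-distribʳ-∪ (s ∷ p) (t ∷ q) (inside  ∷ r) = cong (outside ∷_) (─-distribʳ-∪ p q r)
─-distribʳ-∪ (s ∷ p) (t ∷ q) (outside ∷ r) = cong ((s ∨ t) ∷_) (─-distribʳ-∪ p q r)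

p⊆q⇒p─r⊆q─r : {p q : Subset n} (r : Subset n) → p ⊆ q → p ─ r ⊆ q ─ r
p⊆q⇒p─r⊆q─r {p = _ ∷ _} {q = _ ∷ _} (outside ∷ r) p⊆q here with p⊆q here
... | here = here
p⊆q⇒p─r⊆q─r {p = _ ∷ _} {q = _ ∷ _} (_       ∷ r) p⊆q (there x∈p) =
  there (p⊆q⇒p─r⊆q─r r (drop-∷-⊆ p⊆q) x∈p)

p∪⁅x⁆≡p : {p : Subset n} {x : Fin n} → x ∈ p → p ∪ ⁅ x ⁆ ≡ p
p∪⁅x⁆≡p {p = inside ∷ p} here        = cong (inside ∷_) (∪-identityʳ p)
p∪⁅x⁆≡p {p = s      ∷ p} (there x∈p) = cong₂ _∷_ (∨-identityʳ s) (p∪⁅x⁆≡p x∈p)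

p-x∪⁅x⁆≡p : {p : Subset n} {x : Fin n} → x ∈ p → (p - x) ∪ ⁅ x ⁆ ≡ p
p-x∪⁅x⁆≡p {p = inside ∷ p} here        = cong (inside ∷_) (trans (∪-identityʳ _) (p─⊥≡p p))
p-x∪⁅x⁆≡p {p = s      ∷ p} (there x∈p) = cong₂ _∷_ (∨-identityʳ s) (p-x∪⁅x⁆≡p x∈p)

p∪q≡[p-x∪q]∪⁅x⁆ : {p : Subset n} {x : Fin n} (q : Subset n) → x ∈ p →
                  p ∪ q ≡ ((p - x) ∪ q) ∪ ⁅ x ⁆
p∪q≡[p-x∪q]∪⁅x⁆ {p = p} {x} q x∈p = begin
  p ∪ q                   ≡⟨ cong (_∪ q) (p-x∪⁅x⁆≡p x∈p) ⟨
  ((p - x) ∪ ⁅ x ⁆) ∪ q   ≡⟨ ∪-assoc (p - x) ⁅ x ⁆ q ⟩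
  (p - x) ∪ (⁅ x ⁆ ∪ q)   ≡⟨ cong ((p - x) ∪_) (∪-comm ⁅ x ⁆ q) ⟩
  (p - x) ∪ (q ∪ ⁅ x ⁆)   ≡⟨ ∪-assoc (p - x) q ⁅ x ⁆ ⟨
  ((p - x) ∪ q) ∪ ⁅ x ⁆   ∎
  where open ≡-Reasoning

p∪q≡p-x∪q : {p q : Subset n} {x : Fin n} → x ∈ p → x ∈ q → p ∪ q ≡ (p - x) ∪ q
p∪q≡p-x∪q {p = p} {q} {x} x∈p x∈q = begin
  p ∪ q                   ≡⟨ p∪q≡[p-x∪q]∪⁅x⁆ q x∈p ⟩
  ((p - x) ∪ q) ∪ ⁅ x ⁆   ≡⟨ ∪-assoc (p - x) q ⁅ x ⁆ ⟩
  (p - x) ∪ (q ∪ ⁅ x ⁆)   ≡⟨ cong ((p - x) ∪_) (p∪⁅x⁆≡p x∈q) ⟩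
  (p - x) ∪ q             ∎
  where open ≡-Reasoning

∣∷∣ : (s : Bool) (p : Subset n) → ∣ s ∷ p ∣ ≡ ∣ [ s ] ∣ + ∣ p ∣
∣∷∣ inside  p = refl
∣∷∣ outside p = refl

∣p∪q∣≤∣p∣+∣q∣ : (p q : Subset n) → ∣ p ∪ q ∣ ≤ ∣ p ∣ + ∣ q ∣
∣p∪q∣≤∣p∣+∣q∣ []            []      = z≤n
∣p∪q∣≤∣p∣+∣q∣ (inside  ∷ p) (t ∷ q) =
  s≤s (≤-trans (∣p∪q∣≤∣p∣+∣q∣ p q) (+-monoʳ-≤ ∣ p ∣ (∣p∣≤∣x∷p∣ t q)))
∣p∪q∣≤∣p∣+∣q∣ (outside ∷ p) (inside  ∷ q) =
  subst (suc ∣ p ∪ q ∣ ≤_) (sym (+-suc ∣ p ∣ ∣ q ∣)) (s≤s (∣p∪q∣≤∣p∣+∣q∣ p q))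
∣p∪q∣≤∣p∣+∣q∣ (outside ∷ p) (outside ∷ q) = ∣p∪q∣≤∣p∣+∣q∣ p q

∣p-x─q∣≤∣p─q∣ : (p q : Subset n) (x : Fin n) → ∣ (p - x) ─ q ∣ ≤ ∣ p ─ q ∣
∣p-x─q∣≤∣p─q∣ p q x = p⊆q⇒∣p∣≤∣q∣ (p⊆q⇒p─r⊆q─r q (p─q⊆p p ⁅ x ⁆))

∣p-x─q∣<∣p─q∣ : {p q : Subset n} {x : Fin n} → x ∈ p → x ∉ q → ∣ (p - x) ─ q ∣ < ∣ p ─ q ∣
∣p-x─q∣<∣p─q∣ {p = p} {q} {x} x∈p x∉q =
  subst (_< ∣ p ─ q ∣) (cong ∣_∣ (p─q─r≡p─r─q p q ⁅ x ⁆))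
        (x∈p⇒∣p-x∣<∣p∣ (x∈p∧x∉q⇒x∈p─q x∈p x∉q))

∣p∪⁅x⁆─q∣≤∣p─q∣+1 : (p q : Subset n) (x : Fin n) → ∣ (p ∪ ⁅ x ⁆) ─ q ∣ ≤ ∣ p ─ q ∣ + 1
∣p∪⁅x⁆─q∣≤∣p─q∣+1 p q x = begin
  ∣ (p ∪ ⁅ x ⁆) ─ q ∣           ≡⟨ cong ∣_∣ (─-distribʳ-∪ p ⁅ x ⁆ q) ⟩
  ∣ (p ─ q) ∪ (⁅ x ⁆ ─ q) ∣     ≤⟨ ∣p∪q∣≤∣p∣+∣q∣ (p ─ q) (⁅ x ⁆ ─ q) ⟩
  ∣ p ─ q ∣ + ∣ ⁅ x ⁆ ─ q ∣     ≤⟨ +-monoʳ-≤ ∣ p ─ q ∣ (∣p─q∣≤∣p∣ ⁅ x ⁆ q) ⟩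
  ∣ p ─ q ∣ + ∣ ⁅ x ⁆ ∣         ≡⟨ cong (∣ p ─ q ∣ +_) (∣⁅x⁆∣≡1 x) ⟩
  ∣ p ─ q ∣ + 1                 ∎
  where open ≤-Reasoning

∣∣+∣∣-mono-∷ : (p q r s : Subset (suc n)) →
               ∣ [ head p ] ∣ + ∣ [ head q ] ∣ ≤ ∣ [ head r ] ∣ + ∣ [ head s ] ∣ →
               ∣ tail p ∣ + ∣ tail q ∣ ≤ ∣ tail r ∣ + ∣ tail s ∣ →
               ∣ p ∣ + ∣ q ∣ ≤ ∣ r ∣ + ∣ s ∣
∣∣+∣∣-mono-∷ (a ∷ p) (b ∷ q) (c ∷ r) (d ∷ s) heads tails =
  subst₂ _≤_ (split a p b q) (split c r d s) (+-mono-≤ heads tails)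
  where
  split : ∀ a p b q → (∣ [ a ] ∣ + ∣ [ b ] ∣) + (∣ p ∣ + ∣ q ∣) ≡ ∣ a ∷ p ∣ + ∣ b ∷ q ∣
  split a p b q = trans (interchange ∣ [ a ] ∣ _ _ _) (sym (cong₂ _+_ (∣∷∣ a p) (∣∷∣ b q)))

∣─∣-submodular₁ : (a b c d : Bool) →
                  ∣ [ a ] ∪ [ b ] ─ [ c ] ∪ [ d ] ∣ + ∣ [ a ] ∩ [ b ] ─ [ c ] ∩ [ d ] ∣ ≤
                  ∣ [ a ] ─ [ c ] ∣ + ∣ [ b ] ─ [ d ] ∣
∣─∣-submodular₁ false false false false = ≤ᵇ⇒≤ _ _ _
∣─∣-submodular₁ false false false true  = ≤ᵇ⇒≤ _ _ _
∣─∣-submodular₁ false false true  false = ≤ᵇ⇒≤ _ _ _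
∣─∣-submodular₁ false false true  true  = ≤ᵇ⇒≤ _ _ _
∣─∣-submodular₁ false true  false false = ≤ᵇ⇒≤ _ _ _
∣─∣-submodular₁ false true  false true  = ≤ᵇ⇒≤ _ _ _
∣─∣-submodular₁ false true  true  false = ≤ᵇ⇒≤ _ _ _
∣─∣-submodular₁ false true  true  true  = ≤ᵇ⇒≤ _ _ _
∣─∣-submodular₁ true  false false false = ≤ᵇ⇒≤ _ _ _
∣─∣-submodular₁ true  false false true  = ≤ᵇ⇒≤ _ _ _
∣─∣-submodular₁ true  false true  false = ≤ᵇ⇒≤ _ _ _
∣─∣-submodular₁ true  false true  true  = ≤ᵇ⇒≤ _ _ _
∣─∣-submodular₁ true  true  false false = ≤ᵇ⇒≤ _ _ _
∣─∣-submodular₁ true  true  false true  = ≤ᵇ⇒≤ _ _ _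
∣─∣-submodular₁ true  true  true  false = ≤ᵇ⇒≤ _ _ _
∣─∣-submodular₁ true  true  true  true  = ≤ᵇ⇒≤ _ _ _

∣─∣-submodular : (p q r s : Subset n) →
                 ∣ p ∪ q ─ r ∪ s ∣ + ∣ p ∩ q ─ r ∩ s ∣ ≤ ∣ p ─ r ∣ + ∣ q ─ s ∣
∣─∣-submodular [] [] [] [] = z≤n
∣─∣-submodular (a ∷ p) (b ∷ q) (c ∷ r) (d ∷ s) =
  ∣∣+∣∣-mono-∷ ((a ∷ p) ∪ (b ∷ q) ─ (c ∷ r) ∪ (d ∷ s)) ((a ∷ p) ∩ (b ∷ q) ─ (c ∷ r) ∩ (d ∷ s))
               ((a ∷ p) ─ (c ∷ r)) ((b ∷ q) ─ (d ∷ s))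
               (∣─∣-submodular₁ a b c d) (∣─∣-submodular p q r s)

module _ {D : Subset n → Bool} (L : IsAccessibleDistributiveSublattice D) where
  open IsAccessibleDistributiveSublattice L

  accessible-induction : (P : Subset n → Set) → P ⊥ →
                         (∀ C x → x ∈ C → InFam D (C - x) → P (C - x) → P C) →
                         ∀ C → InFam D C → P C
  accessible-induction P P⊥ P-step C = go C (<-wellFounded ∣ C ∣)
    where
    go : ∀ C → Acc _<_ ∣ C ∣ → InFam D C → P C
    go C (acc rec) C∈D with nonempty? C
    ... | no  C-empty = subst P (sym (Empty-unique C-empty)) P⊥
    ... | yes C-nonempty =
      let x , x∈C , C-x∈D = accessible C C∈D C-nonempty
      in  P-step C x x∈C C-x∈D (go (C - x) (rec (x∈p⇒∣p-x∣<∣p∣ x∈C)) C-x∈D)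

restriction-isURank : {D : Subset n → Bool} {ρ : (A : Subset n) → InFam D A → ℕ}
                      {r : Subset n → ℕ} → IsMatroidRank r →
                      (∀ A (p : InFam D A) → ρ A p ≡ r A) → IsURank D ρ
restriction-isURank r-rank ρ≡r = record
  { rank-∅        = λ p → trans (ρ≡r ⊥ p) (rank-∅ _)
  ; monotone      = λ A B pA pB A⊆B → subst₂ _≤_ (sym (ρ≡r A pA)) (sym (ρ≡r B pB))
                                        (monotone A B _ _ A⊆B)
  ; submodular    = λ A B pA pB pU pI →
      subst₂ _≤_ (sym (cong₂ _+_ (ρ≡r (A ∪ B) pU) (ρ≡r (A ∩ B) pI)))
                 (sym (cong₂ _+_ (ρ≡r A pA) (ρ≡r B pB)))
                 (submodular A B _ _ _ _)
  ; unit-increase = λ A e pA pAe →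
      subst₂ _≤_ (sym (ρ≡r (A ∪ ⁅ e ⁆) pAe)) (sym (cong (_+ 1) (ρ≡r A pA))) (unit-increase A e _ _)
  }
  where open IsURank r-rank

⨅ : (Subset n → ℕ) → ℕ
⨅ {zero}  f = f []
⨅ {suc n} f = ⨅ (λ A → f (outside ∷ A)) ⊓ ⨅ (λ A → f (inside ∷ A))

⨅-≤ : (f : Subset n → ℕ) (A : Subset n) → ⨅ f ≤ f A
⨅-≤ {zero}  f []            = ≤-refl
⨅-≤ {suc n} f (outside ∷ A) = ≤-trans (m⊓n≤m _ _) (⨅-≤ (λ A → f (outside ∷ A)) A)
⨅-≤ {suc n} f (inside  ∷ A) = ≤-trans (m⊓n≤n _ _) (⨅-≤ (λ A → f (inside ∷ A)) A)

⨅-attained : (f : Subset n → ℕ) → ∃ λ A → ⨅ f ≡ f A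
⨅-attained {zero}  f = [] , refl
⨅-attained {suc n} f with ⊓-sel (⨅ (λ A → f (outside ∷ A))) (⨅ (λ A → f (inside ∷ A)))
... | inj₁ ⨅≡ = let A , eq = ⨅-attained (λ A → f (outside ∷ A)) in outside ∷ A , trans ⨅≡ eq
... | inj₂ ⨅≡ = let A , eq = ⨅-attained (λ A → f (inside  ∷ A)) in inside  ∷ A , trans ⨅≡ eq

module Extension {D : Subset n → Bool} (L : IsAccessibleDistributiveSublattice D)
                 {ρ : (A : Subset n) → InFam D A → ℕ} (U : IsURank D ρ) where
  open IsAccessibleDistributiveSublattice L
  open IsURank U

  ρ-cong : ∀ {A B} → A ≡ B → (pA : InFam D A) (pB : InFam D B) → ρ A pA ≡ ρ B pB
  ρ-cong {A} refl pA pB = cong (ρ A) (T-irrelevant pA pB)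

  ρ[C∪B]≤ρB+∣C─B∣ : ∀ B (pB : InFam D B) C → InFam D C → (pCB : InFam D (C ∪ B)) →
                    ρ (C ∪ B) pCB ≤ ρ B pB + ∣ C ─ B ∣
  ρ[C∪B]≤ρB+∣C─B∣ B pB = accessible-induction L P base step
    where
    P : Subset n → Set
    P C = (pCB : InFam D (C ∪ B)) → ρ (C ∪ B) pCB ≤ ρ B pB + ∣ C ─ B ∣

    base : P ⊥
    base p⊥B = ≤-trans (≤-reflexive (ρ-cong (∪-identityˡ B) p⊥B pB)) (m≤m+n _ _)

    step : ∀ C x → x ∈ C → InFam D (C - x) → P (C - x) → P C
    step C x x∈C pC-x ih pCB with x ∈? B
    ... | yes x∈B = begin
      ρ (C ∪ B) pCB                 ≡⟨ ρ-cong (p∪q≡p-x∪q x∈C x∈B) pCB pC-xB ⟩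
      ρ ((C - x) ∪ B) pC-xB         ≤⟨ ih pC-xB ⟩
      ρ B pB + ∣ (C - x) ─ B ∣      ≤⟨ +-monoʳ-≤ (ρ B pB) (∣p-x─q∣≤∣p─q∣ C B x) ⟩
      ρ B pB + ∣ C ─ B ∣            ∎
      where
      open ≤-Reasoning
      pC-xB = ∪-closed (C - x) B pC-x pB
    ... | no x∉B = begin
      ρ (C ∪ B) pCB                 ≡⟨ ρ-cong C∪B≡ pCB pC∪B ⟩
      ρ (((C - x) ∪ B) ∪ ⁅ x ⁆) pC∪B ≤⟨ unit-increase ((C - x) ∪ B) x pC-xB pC∪B ⟩
      ρ ((C - x) ∪ B) pC-xB + 1     ≤⟨ +-monoˡ-≤ 1 (ih pC-xB) ⟩
      ρ B pB + ∣ (C - x) ─ B ∣ + 1  ≡⟨ +-assoc (ρ B pB) _ 1 ⟩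
      ρ B pB + (∣ (C - x) ─ B ∣ + 1) ≤⟨ +-monoʳ-≤ (ρ B pB) (≤-trans (≤-reflexive (+-comm _ 1))
                                                                  (∣p-x─q∣<∣p─q∣ x∈C x∉B)) ⟩
      ρ B pB + ∣ C ─ B ∣            ∎
      where
      open ≤-Reasoning
      pC-xB = ∪-closed (C - x) B pC-x pB
      C∪B≡ = p∪q≡[p-x∪q]∪⁅x⁆ B x∈C
      pC∪B = subst (InFam D) C∪B≡ pCB

  ρA≤ρB+∣A─B∣ : ∀ A B (pA : InFam D A) (pB : InFam D B) → ρ A pA ≤ ρ B pB + ∣ A ─ B ∣
  ρA≤ρB+∣A─B∣ A B pA pB =
    ≤-trans (monotone A (A ∪ B) pA pAB (p⊆p∪q B)) (ρ[C∪B]≤ρB+∣C─B∣ B pB A pA pAB)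
    where pAB = ∪-closed A B pA pB

  -- Off D, ρ is extended by ρ E: such a B never beats E in the minimum defining r,
  -- since ∣ X ─ E ∣ = 0.
  extend : (b : Bool) → (T b → ℕ) → ℕ
  extend true  f = f tt
  extend false _ = ρ ⊤ has-E

  extend-T : ∀ b (f : T b → ℕ) (p : T b) → extend b f ≡ f p
  extend-T true f tt = refl

  extend-cases : ∀ b (f : T b → ℕ) → (∃ λ p → extend b f ≡ f p) ⊎ extend b f ≡ ρ ⊤ has-E
  extend-cases true  f = inj₁ (tt , refl)
  extend-cases false f = inj₂ refl

  r : Subset n → ℕ
  r X = ⨅ λ B → extend (D B) (ρ B) + ∣ X ─ B ∣

  r≤ρB+∣X─B∣ : ∀ X B (pB : InFam D B) → r X ≤ ρ B pB + ∣ X ─ B ∣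
  r≤ρB+∣X─B∣ X B pB =
    subst (r X ≤_) (cong (_+ ∣ X ─ B ∣) (extend-T (D B) (ρ B) pB)) (⨅-≤ _ B)

  r-attained : ∀ X → ∃₂ λ B (pB : InFam D B) → r X ≡ ρ B pB + ∣ X ─ B ∣
  r-attained X with ⨅-attained (λ B → extend (D B) (ρ B) + ∣ X ─ B ∣)
  ... | B , rX≡ with extend-cases (D B) (ρ B)
  ...   | inj₁ (pB , extend≡ρB) = B , pB , trans rX≡ (cong (_+ ∣ X ─ B ∣) extend≡ρB)
  ...   | inj₂ extend≡ρE = ⊤ , has-E , ≤-antisym (r≤ρB+∣X─B∣ X ⊤ has-E) (begin
    ρ ⊤ has-E + ∣ X ─ ⊤ ∣                  ≡⟨ cong (ρ ⊤ has-E +_) (∣p─⊤∣≡0 X) ⟩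
    ρ ⊤ has-E + 0                          ≡⟨ +-identityʳ _ ⟩
    ρ ⊤ has-E                              ≤⟨ m≤m+n _ _ ⟩
    ρ ⊤ has-E + ∣ X ─ B ∣                  ≡⟨ cong (_+ ∣ X ─ B ∣) extend≡ρE ⟨
    extend (D B) (ρ B) + ∣ X ─ B ∣         ≡⟨ rX≡ ⟨
    r X                                    ∎)
    where open ≤-Reasoning

  r-extends : ∀ A (pA : InFam D A) → ρ A pA ≡ r A
  r-extends A pA with r-attained A
  ... | B , pB , rA≡ = ≤-antisym
    (≤-trans (ρA≤ρB+∣A─B∣ A B pA pB) (≤-reflexive (sym rA≡)))
    (≤-trans (r≤ρB+∣X─B∣ A A pA) (≤-reflexive (trans (cong (ρ A pA +_) (∣p─p∣≡0 A)) (+-identityʳ _))))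

  r-⊥ : r ⊥ ≡ 0
  r-⊥ = n≤0⇒n≡0 (≤-trans (r≤ρB+∣X─B∣ ⊥ ⊥ has-∅) (≤-reflexive (cong₂ _+_ (rank-∅ has-∅) (∣p─p∣≡0 (⊥ {n})))))

  r-monotone : ∀ {X Y} → X ⊆ Y → r X ≤ r Y
  r-monotone {X} {Y} X⊆Y =
    let B , pB , rY≡ = r-attained Y
    in  ≤-trans (r≤ρB+∣X─B∣ X B pB)
                (≤-trans (+-monoʳ-≤ (ρ B pB) (p⊆q⇒∣p∣≤∣q∣ (p⊆q⇒p─r⊆q─r B X⊆Y))) (≤-reflexive (sym rY≡)))

  r-submodular : ∀ X Y → r (X ∪ Y) + r (X ∩ Y) ≤ r X + r Y
  r-submodular X Y with r-attained X | r-attained Y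
  ... | A , pA , rX≡ | B , pB , rY≡ = begin
    r (X ∪ Y) + r (X ∩ Y)
      ≤⟨ +-mono-≤ (r≤ρB+∣X─B∣ (X ∪ Y) (A ∪ B) pA∪B) (r≤ρB+∣X─B∣ (X ∩ Y) (A ∩ B) pA∩B) ⟩
    (ρ (A ∪ B) pA∪B + ∣ X ∪ Y ─ A ∪ B ∣) + (ρ (A ∩ B) pA∩B + ∣ X ∩ Y ─ A ∩ B ∣)
      ≡⟨ interchange (ρ (A ∪ B) pA∪B) _ _ _ ⟩
    (ρ (A ∪ B) pA∪B + ρ (A ∩ B) pA∩B) + (∣ X ∪ Y ─ A ∪ B ∣ + ∣ X ∩ Y ─ A ∩ B ∣)
      ≤⟨ +-mono-≤ (submodular A B pA pB pA∪B pA∩B) (∣─∣-submodular X Y A B) ⟩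
    (ρ A pA + ρ B pB) + (∣ X ─ A ∣ + ∣ Y ─ B ∣)
      ≡⟨ interchange (ρ A pA) _ _ _ ⟩
    (ρ A pA + ∣ X ─ A ∣) + (ρ B pB + ∣ Y ─ B ∣)
      ≡⟨ cong₂ _+_ rX≡ rY≡ ⟨
    r X + r Y ∎
    where
    open ≤-Reasoning
    pA∪B = ∪-closed A B pA pB
    pA∩B = ∩-closed A B pA pB

  r-unit-increase : ∀ X e → r (X ∪ ⁅ e ⁆) ≤ r X + 1
  r-unit-increase X e =
    let B , pB , rX≡ = r-attained X
    in  begin
    r (X ∪ ⁅ e ⁆)                ≤⟨ r≤ρB+∣X─B∣ (X ∪ ⁅ e ⁆) B pB ⟩
    ρ B pB + ∣ X ∪ ⁅ e ⁆ ─ B ∣   ≤⟨ +-monoʳ-≤ (ρ B pB) (∣p∪⁅x⁆─q∣≤∣p─q∣+1 X B e) ⟩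
    ρ B pB + (∣ X ─ B ∣ + 1)     ≡⟨ +-assoc (ρ B pB) _ 1 ⟨
    ρ B pB + ∣ X ─ B ∣ + 1       ≡⟨ cong (_+ 1) rX≡ ⟨
    r X + 1                      ∎
    where open ≤-Reasoning

  r-isMatroidRank : IsMatroidRank r
  r-isMatroidRank = record
    { rank-∅        = λ _ → r-⊥
    ; monotone      = λ _ _ _ _ → r-monotone
    ; submodular    = λ X Y _ _ _ _ → r-submodular X Y
    ; unit-increase = λ X e _ _ → r-unit-increase X e
    }

corollary4p13 : (n : ℕ) (D : Subset n → Bool) → IsAccessibleDistributiveSublattice D →
    (ρ : (A : Subset n) → InFam D A → ℕ) →
    IsURank D ρ ⇔ (∃ λ (r : Subset n → ℕ) → IsMatroidRank r × (∀ A (p : InFam D A) → ρ A p ≡ r A))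
corollary4p13 n D L ρ = mk⇔ extension (λ (r , r-rank , ρ≡r) → restriction-isURank r-rank ρ≡r)
  where
  extension : IsURank D ρ → ∃ λ r → IsMatroidRank r × (∀ A (p : InFam D A) → ρ A p ≡ r A)
  extension U = r , r-isMatroidRank , r-extends
    where open Extension L U
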